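{- If $G$ is a permutation graph on $n$ vertices, then $t(G)\le \frac{n}{2}$.
   Context: A graph $G=(V,E)$ is a threshold graph if there exist non-negative reals $w_v$ ($v\in V$) and $t$ such that for every $U\subseteq V$, $\sum_{v\in U} w_v \le t$ if and only if $U$ is a stable (independent) set. The threshold dimension $t(G)$ of a graph $G$ is the least integer $k$ such that there are threshold graphs $T_1,\dots,T_k$ with $V(T_i)=V(G)$ for all $i$ and $E(G)=E(T_1)\cup\cdots\cup E(T_k)$. For a permutation $\Pi$ of $\{1,\dots,n\}$, the graph $G[\Pi]$ has vertex set $\{1,\dots,n\}$ and $i,j$ adjacent iff $(i-j)(\Pi^{ -1}(i)-\Pi^{ -1}(j))<0$; a graph is a permutation graph if it is isomorphic to $G[\Pi]$ for some permutation $\Pi$. -}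

module Defs where

open import Data.Nat as ℕ using (ℕ; zero; suc)
open import Data.Bool using (Bool; true; false; if_then_else_)
open import Data.Fin using (Fin; zero; suc)
import Data.Fin as Fin
open import Data.Fin.Subset using (Subset; _∈_)
open import Data.Fin.Permutation using (Permutation′; _⟨$⟩ʳ_; _⟨$⟩ˡ_)
open import Data.Vec using ([]; _∷_)
open import Data.Rational as ℚ using (ℚ; 0ℚ)
open import Data.Integer as ℤ using (ℤ)
open import Data.Product using (Σ; ∃; _×_; _,_)
open import Data.Empty using (⊥)
open import Relation.Nullary using (¬_)
open import Function using (_∘_; _⇔_)

record Graph (n : ℕ) : Set₁ where
  field
    Adj   : Fin n → Fin n → Set
    sym   : ∀ {u v} → Adj u v → Adj v u
    irrefl : ∀ {u} → ¬ Adj u u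
open Graph public

Stable : ∀ {n} → Graph n → Subset n → Set
Stable G U = ∀ u v → u ∈ U → v ∈ U → ¬ Adj G u v

weightSum : ∀ {n} → (Fin n → ℚ) → Subset n → ℚ
weightSum {zero}  w []      = 0ℚ
weightSum {suc n} w (s ∷ U) = (if s then w zero else 0ℚ) ℚ.+ weightSum (w ∘ suc) U

IsThreshold : ∀ {n} → Graph n → Set
IsThreshold {n} T =
  Σ (Fin n → ℚ) λ w → Σ ℚ λ t →
    (∀ v → 0ℚ ℚ.≤ w v) × (0ℚ ℚ.≤ t) ×
    (∀ (U : Subset n) → (weightSum w U ℚ.≤ t) ⇔ Stable T U)

ThresholdCover : ∀ {n} → Graph n → ℕ → Set₁
ThresholdCover {n} G k =
  Σ (Fin k → Graph n) λ T →
    (∀ i → IsThreshold (T i)) ×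
    (∀ u v → Adj G u v ⇔ ∃ λ i → Adj (T i) u v)

PermAdj : ∀ {n} → Permutation′ n → Fin n → Fin n → Set
PermAdj Π i j =
  (toℤ i ℤ.- toℤ j) ℤ.* (toℤ (Π ⟨$⟩ˡ i) ℤ.- toℤ (Π ⟨$⟩ˡ j)) ℤ.< ℤ.0ℤ
  where
    toℤ : ∀ {n} → Fin n → ℤ
    toℤ x = ℤ.+ (Fin.toℕ x)

IsPermutationGraph : ∀ {n} → Graph n → Set
IsPermutationGraph {n} G =
  Σ (Permutation′ n) λ Π → Σ (Permutation′ n) λ f →
    ∀ u v → Adj G u v ⇔ PermAdj Π (f ⟨$⟩ʳ u) (f ⟨$⟩ʳ v)

module Submission where

-- A permutation graph is the crossing graph of n points (x v , y v) with distinct coordinates: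
-- u and v are adjacent iff one lies to the lower right of the other.  Non-adjacent points are
-- comparable in the product order ≺, so every height level of ≺ is a clique, and a longest
-- ≺-chain is a stable set meeting every level.  A level together with all other vertices, each
-- joined to the level vertices below a threshold on y, is a split graph with nested
-- neighbourhoods, hence a threshold graph, and these graphs cover every edge.  Alternatively,
-- since the chain is stable, the stars centred off the chain cover every edge.  The chain has
-- one vertex per level, so one of the two covers uses at most n / 2 threshold graphs.

open import Level using (0ℓ)
open import Function using (_∘_; _⇔_; mk⇔; case_of_; Equivalence)
open import Function.Bundles using (Injection)
open import Function.Properties.Inverse using (↔⇒↣)
import Function.Properties.Equivalence as ⇔
open import Data.Empty using (⊥-elim)
open import Data.Unit using (tt)
open import Data.Bool using (true; false; if_then_else_)
open import Data.Product using (Σ; ∃; _×_; _,_; proj₁; proj₂)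
open import Data.Product.Function.NonDependent.Propositional using (_×-⇔_)
open import Data.Sum using (_⊎_; inj₁; inj₂; swap)
open import Data.Sum.Function.Propositional using (_⊎-⇔_)
open import Data.Nat as ℕ using (ℕ; zero; suc; _+_; _*_; _∸_; _^_; _≤_; _<_; _⊔_; z≤n; s≤s; z<s; s<s)
import Data.Nat.Properties as ℕ
open import Algebra.Properties.CommutativeSemigroup ℕ.+-commutativeSemigroup using (x∙yz≈y∙xz; xy∙z≈xz∙y)
open import Data.Integer as ℤ using (ℤ; +_; -[1+_]; +[1+_]; _⊖_; 0ℤ)
import Data.Integer.Properties as ℤ
open import Data.Rational as ℚ using (ℚ; 0ℚ)
import Data.Rational.Properties as ℚ
open import Data.Rational.Literals using (fromℤ)
import Data.Rational.Unnormalised as ℚᵘ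
import Data.Rational.Unnormalised.Properties as ℚᵘ
open import Data.Fin as Fin using (Fin; zero; suc; toℕ)
import Data.Fin.Properties as Fin
open import Data.Fin.Subset using (Subset; _∈_)
open import Data.Fin.Subset.Properties using (_∈?_)
open import Data.Fin.Permutation using (Permutation′; _⟨$⟩ʳ_; _⟨$⟩ˡ_; flip)
open import Data.Vec using ([]; _∷_; here; there)
open import Data.List using (List; []; _∷_; length; lookup; filter; allFin)
open import Data.List.Properties using (length-tabulate)
open import Data.List.Membership.Propositional using (lose)
open import Data.List.Membership.Propositional.Properties using (∈-filter⁺; ∈-allFin)
open import Data.List.Relation.Unary.Any as Any using (Any; index)
open import Data.List.Relation.Unary.Any.Properties using (lookup-index)
open import Relation.Nullary using (¬_; Dec; yes; no; does)
open import Relation.Nullary.Decidable using (_×-dec_; _⊎-dec_; dec-true; dec-false)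
open import Relation.Unary using (Pred; Decidable)
open import Relation.Unary.Properties using (∁?; U?)
open import Relation.Binary using (tri<; tri≈; tri>)
open import Relation.Binary.PropositionalEquality

open import Defs hiding (sym)

toℚ : ℕ → ℚ
toℚ n = fromℤ (+ n)

toℚ-+ : ∀ m n → toℚ m ℚ.+ toℚ n ≡ toℚ (m + n)
toℚ-+ m n = ℚ.toℚᵘ-injective (ℚᵘ.≃-trans (ℚ.toℚᵘ-homo-+ (toℚ m) (toℚ n)) (ℚᵘ.*≡* eq))
  where
  eq : ((+ m ℤ.* + 1) ℤ.+ (+ n ℤ.* + 1)) ℤ.* + 1 ≡ + (m + n) ℤ.* (+ 1 ℤ.* + 1)
  eq rewrite ℤ.*-identityʳ (+ m) | ℤ.*-identityʳ (+ n) | ℤ.*-identityʳ (+ m ℤ.+ + n) = refl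

toℚ-mono-≤ : ∀ {m n} → m ≤ n → toℚ m ℚ.≤ toℚ n
toℚ-mono-≤ {m} {n} m≤n =
  ℚ.*≤* (subst₂ ℤ._≤_ (sym (ℤ.*-identityʳ (+ m))) (sym (ℤ.*-identityʳ (+ n))) (ℤ.+≤+ m≤n))

toℚ-cancel-≤ : ∀ {m n} → toℚ m ℚ.≤ toℚ n → m ≤ n
toℚ-cancel-≤ {m} {n} (ℚ.*≤* le) =
  ℤ.drop‿+≤+ (subst₂ ℤ._≤_ (ℤ.*-identityʳ (+ m)) (ℤ.*-identityʳ (+ n)) le)

subsetSum : ∀ {n} → (Fin n → ℕ) → Subset n → ℕ
subsetSum {zero}  w []      = 0
subsetSum {suc n} w (s ∷ U) = (if s then w zero else 0) + subsetSum (w ∘ suc) U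

weightSum-toℚ : ∀ {n} (w : Fin n → ℕ) U → weightSum (toℚ ∘ w) U ≡ toℚ (subsetSum w U)
weightSum-toℚ {zero}  w []          = refl
weightSum-toℚ {suc n} w (true ∷ U)  =
  trans (cong (toℚ (w zero) ℚ.+_) (weightSum-toℚ (w ∘ suc) U)) (toℚ-+ (w zero) _)
weightSum-toℚ {suc n} w (false ∷ U) =
  trans (cong (0ℚ ℚ.+_) (weightSum-toℚ (w ∘ suc) U)) (toℚ-+ 0 _)

subsetSum-≤ : ∀ {n} (w : Fin n → ℕ) U c → (∀ v → v ∈ U → w v ≤ c) → subsetSum w U ≤ n * c
subsetSum-≤ {zero}  w []          c w≤c = z≤n
subsetSum-≤ {suc n} w (true ∷ U)  c w≤c =
  ℕ.+-mono-≤ (w≤c zero here) (subsetSum-≤ (w ∘ suc) U c (λ v v∈U → w≤c (suc v) (there v∈U)))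
subsetSum-≤ {suc n} w (false ∷ U) c w≤c =
  ℕ.≤-trans (subsetSum-≤ (w ∘ suc) U c (λ v v∈U → w≤c (suc v) (there v∈U))) (ℕ.m≤n+m _ c)

subsetSum-member : ∀ {n} (w : Fin n → ℕ) {U v} → v ∈ U → w v ≤ subsetSum w U
subsetSum-member w {true ∷ U} here        = ℕ.m≤m+n _ _
subsetSum-member w {s ∷ U}    (there v∈U) = ℕ.≤-trans (subsetSum-member (w ∘ suc) v∈U) (ℕ.m≤n+m _ _)

subsetSum-pair : ∀ {n} (w : Fin n → ℕ) {U u v} → u ∈ U → v ∈ U → u ≢ v → w u + w v ≤ subsetSum w U
subsetSum-pair w here        here        u≢v = ⊥-elim (u≢v refl)
subsetSum-pair w here        (there v∈U) _   = ℕ.+-monoʳ-≤ (w zero) (subsetSum-member (w ∘ suc) v∈U)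
subsetSum-pair w {u = suc u} (there u∈U) here _ =
  ℕ.≤-trans (ℕ.≤-reflexive (ℕ.+-comm (w (suc u)) (w zero)))
            (ℕ.+-monoʳ-≤ (w zero) (subsetSum-member (w ∘ suc) u∈U))
subsetSum-pair w (there u∈U) (there v∈U) u≢v =
  ℕ.≤-trans (subsetSum-pair (w ∘ suc) u∈U v∈U (u≢v ∘ cong suc)) (ℕ.m≤n+m _ _)

subsetSum-≤-+ : ∀ {n} (w : Fin n → ℕ) {U k} c → k ∈ U → (∀ v → v ∈ U → v ≢ k → w v ≤ c) →
                subsetSum w U ≤ w k + n * c
subsetSum-≤-+ w {true ∷ U} c here w≤c =
  ℕ.+-monoʳ-≤ (w zero)
    (ℕ.≤-trans (subsetSum-≤ (w ∘ suc) U c (λ v v∈U → w≤c (suc v) (there v∈U) λ ())) (ℕ.m≤n+m _ c))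
subsetSum-≤-+ {suc n} w {s ∷ U} {suc k} c (there k∈U) w≤c = begin
  (if s then w zero else 0) + subsetSum (w ∘ suc) U ≤⟨ ℕ.+-mono-≤ (head≤c s w≤c) rest ⟩
  c + (w (suc k) + n * c)                           ≡⟨ x∙yz≈y∙xz c (w (suc k)) (n * c) ⟩
  w (suc k) + (c + n * c)                           ∎
  where
  open ℕ.≤-Reasoning
  rest : subsetSum (w ∘ suc) U ≤ w (suc k) + n * c
  rest = subsetSum-≤-+ (w ∘ suc) c k∈U
           (λ v v∈U v≢k → w≤c (suc v) (there v∈U) (v≢k ∘ Fin.suc-injective))
  head≤c : ∀ s → (∀ v → v ∈ s ∷ U → v ≢ suc k → w v ≤ c) → (if s then w zero else 0) ≤ c
  head≤c true  w≤c = w≤c zero here λ ()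
  head≤c false _   = z≤n

isThreshold-ℕ : ∀ {n} (G : Graph n) (w : Fin n → ℕ) (t : ℕ) →
                (∀ u v → Adj G u v → t < w u + w v) →
                (∀ U → Stable G U → subsetSum w U ≤ t) →
                IsThreshold G
isThreshold-ℕ G w t heavy light =
  toℚ ∘ w , toℚ t , (λ _ → toℚ-mono-≤ z≤n) , toℚ-mono-≤ z≤n , λ U → mk⇔
    (light⇒stable U ∘ toℚ-cancel-≤ ∘ subst (ℚ._≤ toℚ t) (weightSum-toℚ w U))
    (subst (ℚ._≤ toℚ t) (sym (weightSum-toℚ w U)) ∘ toℚ-mono-≤ ∘ light U)
  where
  light⇒stable : ∀ U → subsetSum w U ≤ t → Stable G U
  light⇒stable U ≤t u v u∈U v∈U uv = ℕ.<⇒≱ (heavy u v uv)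
    (ℕ.≤-trans (subsetSum-pair w u∈U v∈U λ { refl → irrefl G uv }) ≤t)

module NestedSplit {n : ℕ} {K : Pred (Fin n) 0ℓ} (K? : Decidable K) (key bound : Fin n → ℕ) (E : ℕ)
                   (key≤E : ∀ v → key v ≤ E) (bound≤E : ∀ v → bound v ≤ E) where

  SplitAdj : Fin n → Fin n → Set
  SplitAdj u v = u ≢ v × (K u × K v ⊎ K u × key u < bound v ⊎ K v × key v < bound u)

  SplitAdj-sym : ∀ {u v} → SplitAdj u v → SplitAdj v u
  SplitAdj-sym (u≢v , inj₁ (Ku , Kv)) = u≢v ∘ sym , inj₁ (Kv , Ku)
  SplitAdj-sym (u≢v , inj₂ (inj₁ uv))  = u≢v ∘ sym , inj₂ (inj₂ uv)
  SplitAdj-sym (u≢v , inj₂ (inj₂ vu))  = u≢v ∘ sym , inj₂ (inj₁ vu)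

  graph : Graph n
  graph = record { Adj = SplitAdj ; sym = SplitAdj-sym ; irrefl = λ uu → proj₁ uu refl }

  -- With B = n + 1 and t = 2 n B ^ E + 1, a vertex v ∉ K weighs B ^ bound v and a vertex
  -- k ∈ K weighs t − n B ^ key k > t / 2.  Two vertices of K, or k with a neighbour v
  -- (weight ≥ B ^ (key k + 1) > n B ^ key k), exceed t; k with non-neighbours, each of weight
  -- ≤ B ^ key k, does not.
  B Z t : ℕ
  B = suc n
  Z = n * B ^ E
  t = Z + suc Z

  shortfall : Fin n → ℕ
  shortfall k = n * B ^ key k

  shortfall≤Z : ∀ k → shortfall k ≤ Z
  shortfall≤Z k = ℕ.*-monoʳ-≤ n (ℕ.^-monoʳ-≤ B (key≤E k))

  cliqueWeight : Fin n → ℕ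
  cliqueWeight k = (Z ∸ shortfall k) + suc Z

  cliqueWeight+shortfall : ∀ k → cliqueWeight k + shortfall k ≡ t
  cliqueWeight+shortfall k = begin
    (Z ∸ shortfall k) + suc Z + shortfall k ≡⟨ xy∙z≈xz∙y (Z ∸ shortfall k) (suc Z) (shortfall k) ⟩
    (Z ∸ shortfall k) + shortfall k + suc Z ≡⟨ cong (_+ suc Z) (ℕ.m∸n+n≡m (shortfall≤Z k)) ⟩
    t                                       ∎
    where open ≡-Reasoning

  shortfall<B^ : ∀ {k m} → key k < m → shortfall k < B ^ m
  shortfall<B^ {k} key<m =
    ℕ.<-≤-trans (ℕ.m<n+m (shortfall k) (ℕ.m^n>0 B (key k))) (ℕ.^-monoʳ-≤ B key<m)

  weight : Fin n → ℕ
  weight v = if does (K? v) then cliqueWeight v else B ^ bound v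

  weight-K : ∀ {v} → K v → weight v ≡ cliqueWeight v
  weight-K {v} Kv = cong (if_then cliqueWeight v else B ^ bound v) (dec-true (K? v) Kv)

  weight-∁K : ∀ {v} → ¬ K v → weight v ≡ B ^ bound v
  weight-∁K {v} ¬Kv = cong (if_then cliqueWeight v else B ^ bound v) (dec-false (K? v) ¬Kv)

  heavy-K-K : ∀ {u v} → K u → K v → t < weight u + weight v
  heavy-K-K {u} {v} Ku Kv rewrite weight-K Ku | weight-K Kv =
    ℕ.+-mono-≤ (ℕ.m≤n+m (suc Z) (Z ∸ shortfall u)) (ℕ.m≤n+m (suc Z) (Z ∸ shortfall v))

  heavy-K : ∀ {u v} → K u → key u < bound v → t < weight u + weight v
  heavy-K {u} {v} Ku key<bound = case K? v of λ where
    (yes Kv) → heavy-K-K Ku Kv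
    (no ¬Kv) → subst₂ _<_ (cliqueWeight+shortfall u) (sym (cong₂ _+_ (weight-K Ku) (weight-∁K ¬Kv)))
                     (ℕ.+-monoʳ-< (cliqueWeight u) (shortfall<B^ key<bound))

  heavy : ∀ u v → SplitAdj u v → t < weight u + weight v
  heavy u v (_ , inj₁ (Ku , Kv))            = heavy-K-K Ku Kv
  heavy u v (_ , inj₂ (inj₁ (Ku , key<b)))  = heavy-K Ku key<b
  heavy u v (_ , inj₂ (inj₂ (Kv , key<b)))  = subst (t <_) (ℕ.+-comm (weight v) (weight u)) (heavy-K Kv key<b)

  light : ∀ U → Stable graph U → subsetSum weight U ≤ t
  light U stable with Fin.any? (λ k → k ∈? U ×-dec K? k)
  ... | yes (k , k∈U , Kk) = begin
    subsetSum weight U                ≤⟨ subsetSum-≤-+ weight (B ^ key k) k∈U others-light ⟩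
    weight k + shortfall k            ≡⟨ cong (_+ shortfall k) (weight-K Kk) ⟩
    cliqueWeight k + shortfall k      ≡⟨ cliqueWeight+shortfall k ⟩
    t                                 ∎
    where
    open ℕ.≤-Reasoning
    others-light : ∀ v → v ∈ U → v ≢ k → weight v ≤ B ^ key k
    others-light v v∈U v≢k = case K? v of λ where
      (yes Kv) → ⊥-elim (stable k v k∈U v∈U (v≢k ∘ sym , inj₁ (Kk , Kv)))
      (no ¬Kv) → subst (_≤ B ^ key k) (sym (weight-∁K ¬Kv)) (ℕ.^-monoʳ-≤ B (ℕ.≮⇒≥ λ key<bound →
                     stable k v k∈U v∈U (v≢k ∘ sym , inj₂ (inj₁ (Kk , key<bound)))))
  ... | no noK = ℕ.≤-trans (subsetSum-≤ weight U (B ^ E) all-light) (ℕ.m≤m+n Z (suc Z))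
    where
    all-light : ∀ v → v ∈ U → weight v ≤ B ^ E
    all-light v v∈U = subst (_≤ B ^ E) (sym (weight-∁K λ Kv → noK (v , v∈U , Kv)))
                            (ℕ.^-monoʳ-≤ B (bound≤E v))

  isThreshold : IsThreshold graph
  isThreshold = isThreshold-ℕ graph weight t heavy light

thresholdCover : ∀ {n} {A : Set} (G : Graph n) (T : A → Graph n) (cs : List A) →
                 (∀ c → IsThreshold (T c)) →
                 (∀ c {u v} → Adj (T c) u v → Adj G u v) →
                 (∀ {u v} → Adj G u v → Any (λ c → Adj (T c) u v) cs) →
                 ThresholdCover G (length cs)
thresholdCover G T cs threshold sub cover =
  T ∘ lookup cs , threshold ∘ lookup cs , λ u v → mk⇔
    (λ uv → index (cover uv) , lookup-index (cover uv))
    (λ (i , uv) → sub (lookup cs i) uv)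

length-filter-∁ : ∀ {A : Set} {P : Pred A 0ℓ} (P? : Decidable P) xs →
                  length (filter P? xs) + length (filter (∁? P?) xs) ≡ length xs
length-filter-∁ P? []       = refl
length-filter-∁ P? (x ∷ xs) with does (P? x)
... | true  = cong suc (length-filter-∁ P? xs)
... | false = trans (ℕ.+-suc _ _) (cong suc (length-filter-∁ P? xs))

double≤+ : ∀ {a b} → a ≤ b → 2 * a ≤ a + b
double≤+ {a} a≤b = ℕ.+-monoʳ-≤ a (subst (_≤ _) (sym (ℕ.+-identityʳ a)) a≤b)

maxOver : ∀ {n} {P : Pred (Fin n) 0ℓ} → Decidable P → (Fin n → ℕ) → ℕ
maxOver {zero}  P? g = 0
maxOver {suc n} P? g = (if does (P? zero) then g zero else 0) ⊔ maxOver (P? ∘ suc) (g ∘ suc)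

maxOver-ub : ∀ {n} {P : Pred (Fin n) 0ℓ} (P? : Decidable P) (g : Fin n → ℕ) {i} → P i → g i ≤ maxOver P? g
maxOver-ub P? g {zero}  P0 rewrite dec-true (P? zero) P0 = ℕ.m≤m⊔n _ _
maxOver-ub P? g {suc i} Pi = ℕ.≤-trans (maxOver-ub (P? ∘ suc) (g ∘ suc) Pi) (ℕ.m≤n⊔m _ _)

maxOver-lub : ∀ {n} {P : Pred (Fin n) 0ℓ} (P? : Decidable P) (g : Fin n → ℕ) {c} →
              (∀ i → P i → g i ≤ c) → maxOver P? g ≤ c
maxOver-lub {zero}  P? g g≤c = z≤n
maxOver-lub {suc n} P? g {c} g≤c = ℕ.⊔-lub head≤c (maxOver-lub (P? ∘ suc) (g ∘ suc) (g≤c ∘ suc))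
  where
  head≤c : (if does (P? zero) then g zero else 0) ≤ c
  head≤c with P? zero
  ... | yes P0 = g≤c zero P0
  ... | no _   = z≤n

maxOver-attained : ∀ {n} {P : Pred (Fin n) 0ℓ} (P? : Decidable P) (g : Fin n → ℕ) →
                   0 < maxOver P? g → ∃ λ i → P i × g i ≡ maxOver P? g
maxOver-attained {suc n} P? g pos with P? zero
... | no _ = let i , Pi , gi≡ = maxOver-attained (P? ∘ suc) (g ∘ suc) pos in suc i , Pi , gi≡
... | yes P0 with ℕ.≤-total (maxOver (P? ∘ suc) (g ∘ suc)) (g zero)
...   | inj₁ rest≤g0 = zero , P0 , sym (ℕ.m≥n⇒m⊔n≡m rest≤g0)
...   | inj₂ g0≤rest =
  let i , Pi , gi≡ = maxOver-attained (P? ∘ suc) (g ∘ suc) (subst (0 <_) (ℕ.m≤n⇒m⊔n≡n g0≤rest) pos)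
  in suc i , Pi , trans gi≡ (sym (ℕ.m≤n⇒m⊔n≡n g0≤rest))

maxOver-cong : ∀ {n} {P : Pred (Fin n) 0ℓ} (P? : Decidable P) {g h : Fin n → ℕ} →
               (∀ i → P i → g i ≡ h i) → maxOver P? g ≡ maxOver P? h
maxOver-cong {zero}  P? g≡h = refl
maxOver-cong {suc n} P? {g} {h} g≡h = cong₂ _⊔_ head≡ (maxOver-cong (P? ∘ suc) (g≡h ∘ suc))
  where
  head≡ : (if does (P? zero) then g zero else 0) ≡ (if does (P? zero) then h zero else 0)
  head≡ with P? zero
  ... | yes P0 = g≡h zero P0
  ... | no _   = refl

*-<0⇔ : ∀ i j → i ℤ.* j ℤ.< 0ℤ ⇔ (i ℤ.< 0ℤ × 0ℤ ℤ.< j ⊎ 0ℤ ℤ.< i × j ℤ.< 0ℤ)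
*-<0⇔ i (+ zero) rewrite ℤ.*-zeroʳ i =
  mk⇔ (λ { (ℤ.+<+ ()) }) λ { (inj₁ (_ , ℤ.+<+ ())) ; (inj₂ (_ , ℤ.+<+ ())) }
*-<0⇔ (+ zero)   j          = mk⇔ (λ { (ℤ.+<+ ()) }) λ { (inj₁ (ℤ.+<+ () , _)) ; (inj₂ (ℤ.+<+ () , _)) }
*-<0⇔ +[1+ a ]   +[1+ b ]   = mk⇔ (λ { (ℤ.+<+ ()) }) λ { (inj₁ (ℤ.+<+ () , _)) ; (inj₂ (_ , ℤ.+<+ ())) }
*-<0⇔ +[1+ a ]   -[1+ b ]   = mk⇔ (λ _ → inj₂ (ℤ.+<+ z<s , ℤ.-<+)) (λ _ → ℤ.-<+)
*-<0⇔ -[1+ a ]   +[1+ b ]   = mk⇔ (λ _ → inj₁ (ℤ.-<+ , ℤ.+<+ z<s)) (λ _ → ℤ.-<+)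
*-<0⇔ -[1+ a ]   -[1+ b ]   = mk⇔ (λ { (ℤ.+<+ ()) }) λ { (inj₁ (_ , ())) ; (inj₂ (() , _)) }

⊖<0⇔ : ∀ m n → m ⊖ n ℤ.< 0ℤ ⇔ m < n
⊖<0⇔ zero    zero    = mk⇔ (λ { (ℤ.+<+ ()) }) λ ()
⊖<0⇔ zero    (suc n) = mk⇔ (λ _ → z<s) (λ _ → ℤ.-<+)
⊖<0⇔ (suc m) zero    = mk⇔ (λ { (ℤ.+<+ ()) }) λ ()
⊖<0⇔ (suc m) (suc n) rewrite ℤ.[1+m]⊖[1+n]≡m⊖n m n = mk⇔ (s<s ∘ to) (from ∘ ℕ.s<s⁻¹)
  where open Equivalence (⊖<0⇔ m n)

0<⊖⇔ : ∀ m n → 0ℤ ℤ.< m ⊖ n ⇔ n < m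
0<⊖⇔ zero    zero    = mk⇔ (λ { (ℤ.+<+ ()) }) λ ()
0<⊖⇔ zero    (suc n) = mk⇔ (λ ()) λ ()
0<⊖⇔ (suc m) zero    = mk⇔ (λ _ → z<s) (λ _ → ℤ.+<+ z<s)
0<⊖⇔ (suc m) (suc n) rewrite ℤ.[1+m]⊖[1+n]≡m⊖n m n = mk⇔ (s<s ∘ to) (from ∘ ℕ.s<s⁻¹)
  where open Equivalence (0<⊖⇔ m n)

-*-<0⇔ : ∀ a b c d → (+ a ℤ.- + b) ℤ.* (+ c ℤ.- + d) ℤ.< 0ℤ ⇔ (a < b × d < c ⊎ b < a × c < d)
-*-<0⇔ a b c d rewrite ℤ.m-n≡m⊖n a b | ℤ.m-n≡m⊖n c d = ⇔.trans (*-<0⇔ (a ⊖ b) (c ⊖ d))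
  ((⊖<0⇔ a b ×-⇔ 0<⊖⇔ c d) ⊎-⇔ (0<⊖⇔ a b ×-⇔ ⊖<0⇔ c d))

module CrossingGraph {n : ℕ} (x y : Fin n → Fin n)
                     (x-injective : ∀ {u v} → x u ≡ x v → u ≡ v)
                     (y-injective : ∀ {u v} → y u ≡ y v → u ≡ v) where

  infix 4 _↘_ _↘?_ _≺_ _≺?_

  _↘_ : Fin n → Fin n → Set
  u ↘ v = x v Fin.< x u × y u Fin.< y v

  _↘?_ : ∀ u v → Dec (u ↘ v)
  u ↘? v = x v Fin.<? x u ×-dec y u Fin.<? y v

  ↘⇒≢ : ∀ {u v} → u ↘ v → u ≢ v
  ↘⇒≢ (xv<xu , _) refl = Fin.<-irrefl refl xv<xu

  Crosses : Fin n → Fin n → Set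
  Crosses u v = v ↘ u ⊎ u ↘ v

  Crosses? : ∀ u v → Dec (Crosses u v)
  Crosses? u v = (v ↘? u) ⊎-dec (u ↘? v)

  Crosses⇒≢ : ∀ {u v} → Crosses u v → u ≢ v
  Crosses⇒≢ (inj₁ v↘u) = ↘⇒≢ v↘u ∘ sym
  Crosses⇒≢ (inj₂ u↘v) = ↘⇒≢ u↘v

  _≺_ : Fin n → Fin n → Set
  u ≺ v = x u Fin.< x v × y u Fin.< y v

  _≺?_ : ∀ u v → Dec (u ≺ v)
  u ≺? v = x u Fin.<? x v ×-dec y u Fin.<? y v

  ≺-trans : ∀ {u v w} → u ≺ v → v ≺ w → u ≺ w
  ≺-trans (xu<xv , yu<yv) (xv<xw , yv<yw) = Fin.<-trans xu<xv xv<xw , Fin.<-trans yu<yv yv<yw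

  ≺⇒¬Crosses : ∀ {u v} → u ≺ v → ¬ Crosses u v
  ≺⇒¬Crosses (_ , yu<yv) (inj₁ (_ , yv<yu)) = Fin.<-asym yu<yv yv<yu
  ≺⇒¬Crosses (xu<xv , _) (inj₂ (xv<xu , _)) = Fin.<-asym xu<xv xv<xu

  ≺-or-Crosses : ∀ {u v} → u ≢ v → u ≺ v ⊎ v ≺ u ⊎ Crosses u v
  ≺-or-Crosses {u} {v} u≢v with Fin.<-cmp (x u) (x v) | Fin.<-cmp (y u) (y v)
  ... | tri≈ _ xu≡xv _ | _              = ⊥-elim (u≢v (x-injective xu≡xv))
  ... | _              | tri≈ _ yu≡yv _ = ⊥-elim (u≢v (y-injective yu≡yv))
  ... | tri< xu<xv _ _ | tri< yu<yv _ _ = inj₁ (xu<xv , yu<yv)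
  ... | tri< xu<xv _ _ | tri> _ _ yv<yu = inj₂ (inj₂ (inj₁ (xu<xv , yv<yu)))
  ... | tri> _ _ xv<xu | tri< yu<yv _ _ = inj₂ (inj₂ (inj₂ (xv<xu , yu<yv)))
  ... | tri> _ _ xv<xu | tri> _ _ yv<yu = inj₂ (inj₁ (xv<xu , yv<yu))

  -- Fuel k suffices once it exceeds x v, since x increases strictly along ≺.
  heightWithin : ℕ → Fin n → ℕ
  heightWithin zero    v = 0
  heightWithin (suc k) v = suc (maxOver (_≺? v) (heightWithin k))

  heightWithin-stable : ∀ k v → toℕ (x v) < k → heightWithin k v ≡ heightWithin (suc k) v
  heightWithin-stable (suc k) v xv<1+k = cong suc (maxOver-cong (_≺? v) λ u (xu<xv , _) →
    heightWithin-stable k u (ℕ.<-≤-trans xu<xv (ℕ.s≤s⁻¹ xv<1+k)))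

  height : Fin n → ℕ
  height = heightWithin n

  height-unfold : ∀ v → height v ≡ suc (maxOver (_≺? v) height)
  height-unfold v = heightWithin-stable n v (Fin.toℕ<n (x v))

  height-pos : ∀ v → 0 < height v
  height-pos v rewrite height-unfold v = z<s

  ≺⇒height< : ∀ {u v} → u ≺ v → height u < height v
  ≺⇒height< {u} {v} u≺v rewrite height-unfold v = s≤s (maxOver-ub (_≺? v) height u≺v)

  height-predecessor : ∀ v → 1 < height v → ∃ λ u → u ≺ v × suc (height u) ≡ height v
  height-predecessor v 1<hv =
    let u , u≺v , hu≡max = maxOver-attained (_≺? v) height (ℕ.s<s⁻¹ (subst (1 <_) (height-unfold v) 1<hv))
    in u , u≺v , trans (cong suc hu≡max) (sym (height-unfold v))

  sameHeight⇒Crosses : ∀ {u v} → u ≢ v → height u ≡ height v → Crosses u v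
  sameHeight⇒Crosses u≢v hu≡hv with ≺-or-Crosses u≢v
  ... | inj₁ u≺v        = ⊥-elim (ℕ.<-irrefl hu≡hv (≺⇒height< u≺v))
  ... | inj₂ (inj₁ v≺u) = ⊥-elim (ℕ.<-irrefl (sym hu≡hv) (≺⇒height< v≺u))
  ... | inj₂ (inj₂ c)   = c

  sameHeight-antitone : ∀ {u v} → height u ≡ height v → y u Fin.≤ y v → x v Fin.≤ x u
  sameHeight-antitone {u} {v} hu≡hv yu≤yv with u Fin.≟ v
  ... | yes refl = Fin.≤-refl
  ... | no u≢v with sameHeight⇒Crosses u≢v hu≡hv
  ...   | inj₁ (_ , yv<yu) = ⊥-elim (ℕ.<⇒≱ yv<yu yu≤yv)
  ...   | inj₂ (xv<xu , _) = ℕ.<⇒≤ xv<xu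

  module LongestChain (top : Fin n) (top-max : ∀ v → height v ≤ height top) where

    H : ℕ
    H = height top

    below : Fin n → Fin n
    below v with 1 ℕ.<? height v
    ... | yes 1<hv = proj₁ (height-predecessor v 1<hv)
    ... | no _     = v

    below-spec : ∀ v → 1 < height v → below v ≺ v × suc (height (below v)) ≡ height v
    below-spec v 1<hv with 1 ℕ.<? height v
    ... | yes 1<hv′ = proj₂ (height-predecessor v 1<hv′)
    ... | no ¬1<hv  = ⊥-elim (¬1<hv 1<hv)

    chain : ℕ → Fin n
    chain zero    = top
    chain (suc k) = below (chain k)

    height-chain : ∀ k → k < H → height (chain k) + k ≡ H
    chain-high : ∀ k → suc k < H → 1 < height (chain k)

    height-chain zero    _     = ℕ.+-identityʳ H
    height-chain (suc k) 1+k<H = begin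
      height (chain (suc k)) + suc k   ≡⟨ ℕ.+-suc _ k ⟩
      suc (height (chain (suc k))) + k ≡⟨ cong (_+ k) (proj₂ (below-spec (chain k) (chain-high k 1+k<H))) ⟩
      height (chain k) + k             ≡⟨ height-chain k (ℕ.<-trans (ℕ.n<1+n k) 1+k<H) ⟩
      H                                ∎
      where open ≡-Reasoning

    chain-high k 1+k<H = ℕ.+-cancelʳ-≤ k 2 (height (chain k))
      (subst (2 + k ≤_) (sym (height-chain k (ℕ.<-trans (ℕ.n<1+n k) 1+k<H))) 1+k<H)

    chain-step : ∀ k → suc k < H → chain (suc k) ≺ chain k
    chain-step k 1+k<H = proj₁ (below-spec (chain k) (chain-high k 1+k<H))

    chain-≺ : ∀ {k k′} → k < k′ → k′ < H → chain k′ ≺ chain k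
    chain-≺ {k} {suc k′} k<1+k′ 1+k′<H with ℕ.m<1+n⇒m<n∨m≡n k<1+k′
    ... | inj₁ k<k′ =
      ≺-trans (chain-step k′ 1+k′<H) (chain-≺ k<k′ (ℕ.<-trans (ℕ.n<1+n k′) 1+k′<H))
    ... | inj₂ refl = chain-step k′ 1+k′<H

    -- chain k is the chain vertex of height H − k.
    InChain : Pred (Fin n) 0ℓ
    InChain v = v ≡ chain (H ∸ height v)

    InChain? : Decidable InChain
    InChain? v = v Fin.≟ chain (H ∸ height v)

    chain-index< : ∀ v → H ∸ height v < H
    chain-index< v = ℕ.∸-monoʳ-< {o = 0} (height-pos v) (top-max v)

    height-chain-index : ∀ w → height (chain (H ∸ height w)) ≡ height w
    height-chain-index w = ℕ.+-cancelʳ-≡ (H ∸ height w) _ _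
      (trans (height-chain _ (chain-index< w)) (sym (ℕ.m+[n∸m]≡n (top-max w))))

    chain-meets-every-height : ∀ w → ∃ λ c → InChain c × height c ≡ height w
    chain-meets-every-height w =
      chain (H ∸ height w) , cong (λ h → chain (H ∸ h)) (sym (height-chain-index w)) , height-chain-index w

    InChain-≺ : ∀ {u v} → InChain u → InChain v → height u < height v → u ≺ v
    InChain-≺ {u} {v} u∈ v∈ hu<hv =
      subst₂ _≺_ (sym u∈) (sym v∈) (chain-≺ (ℕ.∸-monoʳ-< hu<hv (top-max v)) (chain-index< u))

    chain-stable : ∀ {u v} → InChain u → InChain v → ¬ Crosses u v
    chain-stable {u} {v} u∈ v∈ c with ℕ.<-cmp (height u) (height v)
    ... | tri< hu<hv _ _ = ≺⇒¬Crosses (InChain-≺ u∈ v∈ hu<hv) c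
    ... | tri≈ _ hu≡hv _ = Crosses⇒≢ c (trans u∈ (trans (cong (λ h → chain (H ∸ h)) hu≡hv) (sym v∈)))
    ... | tri> _ _ hv<hu = ≺⇒¬Crosses (InChain-≺ v∈ u∈ hv<hu) (swap c)

  highest : Fin n → ∃ λ top → ∀ v → height v ≤ height top
  highest w =
    let top , _ , htop≡max = maxOver-attained U? height (ℕ.≤-trans (height-pos w) (maxOver-ub U? height tt))
    in top , λ v → subst (height v ≤_) (sym htop≡max) (maxOver-ub U? height tt)

  LevelNeighbour : ℕ → Fin n → Pred (Fin n) 0ℓ
  LevelNeighbour j v k = height k ≡ j × k ↘ v

  levelNeighbour? : ∀ j v → Decidable (LevelNeighbour j v)
  levelNeighbour? j v k = (height k ℕ.≟ j) ×-dec (k ↘? v)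

  levelBound : ℕ → Fin n → ℕ
  levelBound j v = maxOver (levelNeighbour? j v) (suc ∘ toℕ ∘ y)

  levelBound≤n : ∀ j v → levelBound j v ≤ n
  levelBound≤n j v = maxOver-lub (levelNeighbour? j v) (suc ∘ toℕ ∘ y) λ k _ → Fin.toℕ<n (y k)

  module LevelSplit (j : ℕ) = NestedSplit (λ u → height u ℕ.≟ j) (toℕ ∘ y) (levelBound j) n
                                     (λ v → ℕ.<⇒≤ (Fin.toℕ<n (y v))) (levelBound≤n j)

  belowLevelBound⇒↘ : ∀ {j u v} → height u ≡ j → toℕ (y u) < levelBound j v → u ↘ v
  belowLevelBound⇒↘ {j} {u} {v} hu≡j yu<bound =
    let k , (hk≡j , xv<xk , yk<yv) , 1+yk≡bound =
          maxOver-attained (levelNeighbour? j v) (suc ∘ toℕ ∘ y) (ℕ.<-≤-trans z<s yu<bound)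
        yu≤yk = ℕ.s≤s⁻¹ (subst (toℕ (y u) <_) (sym 1+yk≡bound) yu<bound)
    in ℕ.<-≤-trans xv<xk (sameHeight-antitone (trans hu≡j (sym hk≡j)) yu≤yk) , ℕ.≤-<-trans yu≤yk yk<yv

  Level⊆Crosses : ∀ j {u v} → LevelSplit.SplitAdj j u v → Crosses u v
  Level⊆Crosses j (u≢v , inj₁ (hu≡j , hv≡j))       = sameHeight⇒Crosses u≢v (trans hu≡j (sym hv≡j))
  Level⊆Crosses j (_   , inj₂ (inj₁ (hu≡j , yu<b))) = inj₂ (belowLevelBound⇒↘ hu≡j yu<b)
  Level⊆Crosses j (_   , inj₂ (inj₂ (hv≡j , yv<b))) = inj₁ (belowLevelBound⇒↘ hv≡j yv<b)

  ↘⇒Level : ∀ {u v} → u ↘ v → LevelSplit.SplitAdj (height u) u v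
  ↘⇒Level {u} {v} u↘v =
    ↘⇒≢ u↘v ,
    inj₂ (inj₁ (refl , maxOver-ub (levelNeighbour? (height u) v) (suc ∘ toℕ ∘ y) (refl , u↘v)))

  starBound : Fin n → Fin n → ℕ
  starBound c v with Crosses? c v
  ... | yes _ = 1
  ... | no _  = 0

  starBound≤1 : ∀ c v → starBound c v ≤ 1
  starBound≤1 c v with Crosses? c v
  ... | yes _ = ℕ.≤-refl
  ... | no _  = z≤n

  Crosses⇒starBound-pos : ∀ {c v} → Crosses c v → 0 < starBound c v
  Crosses⇒starBound-pos {c} {v} cv with Crosses? c v
  ... | yes _  = z<s
  ... | no ¬cv = ⊥-elim (¬cv cv)

  starBound-pos⇒Crosses : ∀ {c v} → 0 < starBound c v → Crosses c v
  starBound-pos⇒Crosses {c} {v} pos with Crosses? c v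
  ... | yes cv = cv

  module Star (c : Fin n) =
    NestedSplit (λ u → u Fin.≟ c) (λ _ → 0) (starBound c) 1 (λ _ → z≤n) (starBound≤1 c)

  Star⊆Crosses : ∀ c {u v} → Star.SplitAdj c u v → Crosses u v
  Star⊆Crosses c (u≢v , inj₁ (refl , refl))  = ⊥-elim (u≢v refl)
  Star⊆Crosses c (_   , inj₂ (inj₁ (refl , pos))) = starBound-pos⇒Crosses pos
  Star⊆Crosses c (_   , inj₂ (inj₂ (refl , pos))) = swap (starBound-pos⇒Crosses pos)

  Crosses⇒Star : ∀ {c v} → Crosses c v → Star.SplitAdj c c v
  Crosses⇒Star cv = Crosses⇒≢ cv , inj₂ (inj₁ (refl , Crosses⇒starBound-pos cv))

  module _ (G : Graph n) (adj⇔Crosses : ∀ u v → Adj G u v ⇔ Crosses u v)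
           (top : Fin n) (top-max : ∀ v → height v ≤ height top) where

    open LongestChain top top-max

    chainVertices offChain : List (Fin n)
    chainVertices = filter InChain? (allFin n)
    offChain      = filter (∁? InChain?) (allFin n)

    levelCover : ThresholdCover G (length chainVertices)
    levelCover =
      thresholdCover G (LevelSplit.graph ∘ height) chainVertices (LevelSplit.isThreshold ∘ height)
      (λ c {u} {v} → Equivalence.from (adj⇔Crosses u v) ∘ Level⊆Crosses (height c)) covered
      where
      atLevelOf : ∀ {u v} → u ↘ v → Any (λ c → LevelSplit.SplitAdj (height c) u v) chainVertices
      atLevelOf {u} {v} u↘v =
        let c , c∈ , hc≡hu = chain-meets-every-height u
        in lose (∈-filter⁺ InChain? (∈-allFin c) c∈)
                (subst (λ j → LevelSplit.SplitAdj j u v) (sym hc≡hu) (↘⇒Level u↘v))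
      covered : ∀ {u v} → Adj G u v → Any (λ c → LevelSplit.SplitAdj (height c) u v) chainVertices
      covered {u} {v} uv with Equivalence.to (adj⇔Crosses u v) uv
      ... | inj₁ v↘u = Any.map (λ {c} → LevelSplit.SplitAdj-sym (height c)) (atLevelOf v↘u)
      ... | inj₂ u↘v = atLevelOf u↘v

    starCover : ThresholdCover G (length offChain)
    starCover = thresholdCover G Star.graph offChain Star.isThreshold
      (λ c {u} {v} → Equivalence.from (adj⇔Crosses u v) ∘ Star⊆Crosses c) covered
      where
      covered : ∀ {u v} → Adj G u v → Any (λ c → Star.SplitAdj c u v) offChain
      covered {u} {v} uv with Equivalence.to (adj⇔Crosses u v) uv | InChain? u | InChain? v
      ... | uv′ | no u∉ | _     = lose (∈-filter⁺ (∁? InChain?) (∈-allFin u) u∉) (Crosses⇒Star uv′)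
      ... | uv′ | yes _ | no v∉ = lose (∈-filter⁺ (∁? InChain?) (∈-allFin v) v∉)
                                       (Star.SplitAdj-sym v (Crosses⇒Star (swap uv′)))
      ... | uv′ | yes u∈ | yes v∈ = ⊥-elim (chain-stable u∈ v∈ uv′)

    chainVertices+offChain : length chainVertices + length offChain ≡ n
    chainVertices+offChain = trans (length-filter-∁ InChain? (allFin n)) (length-tabulate (λ i → i))

    halfCover : Σ ℕ λ k → 2 * k ≤ n × ThresholdCover G k
    halfCover with length chainVertices ℕ.≤? length offChain
    ... | yes fewer = length chainVertices ,
                      subst (2 * length chainVertices ≤_) chainVertices+offChain (double≤+ fewer) , levelCover
    ... | no more   = length offChain ,
                      subst (2 * length offChain ≤_)
                            (trans (ℕ.+-comm (length offChain) (length chainVertices)) chainVertices+offChain)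
                            (double≤+ (ℕ.<⇒≤ (ℕ.≰⇒> more))) , starCover

⟨$⟩ʳ-injective : ∀ {n} (π : Permutation′ n) {i j} → π ⟨$⟩ʳ i ≡ π ⟨$⟩ʳ j → i ≡ j
⟨$⟩ʳ-injective π = Injection.injective (↔⇒↣ π)

theorem5 : ∀ (n : ℕ) (G : Graph n) → IsPermutationGraph G →
    Σ ℕ (λ k → (2 * k ≤ n) × ThresholdCover G k)
theorem5 zero    G _              = 0 , z≤n , (λ ()) , (λ ()) , (λ ())
theorem5 (suc m) G (Π , f , adj⇔) = let top , top-max = highest zero in halfCover G adj⇔Crosses top top-max
  where
  x y : Fin (suc m) → Fin (suc m)
  x = f ⟨$⟩ʳ_
  y = (Π ⟨$⟩ˡ_) ∘ x
  open CrossingGraph x y (⟨$⟩ʳ-injective f) (⟨$⟩ʳ-injective f ∘ ⟨$⟩ʳ-injective (flip Π))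
  adj⇔Crosses : ∀ u v → Adj G u v ⇔ Crosses u v
  adj⇔Crosses u v = ⇔.trans (adj⇔ u v) (-*-<0⇔ _ _ _ _)
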